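{- Let $\alpha$ be a producible assembly of an SFTAM tile assembly system $S$ on $\mathbb{Z}^2$, with underlying rectangle $R$, and let $C$ be a polycube. If there exists a function $i$ from (the unit squares of) $\mathbb{Z}^2$ to (the facets of the surface of) $C$ whose restriction to $R$ is a graph isomorphism onto its image (with respect to side-adjacency of squares/facets), then the image of $\alpha$ under $i$ (each tile placed at square $p$ of $\mathbb{Z}^2$ being placed at facet $i(p)$ with the corresponding orientation) is a producible assembly of $S$ on $C$.
   Context: SFTAM: a tile type is a 4-tuple of glue labels from $\Sigma\cup\{\epsilon\}$; tiles are unit squares that may be translated and rotated but not mirrored. A TAS is $(\Sigma,T,\sigma,str,\tau)$ with seed $\sigma$, strength function $str$ ($str(\epsilon)=0$) and temperature $\tau$. On a surface (either $\mathbb{Z}^2$ or the boundary of a polycube $C$, a union of unit cubes of $\mathbb{Z}^3$ glued along faces), an assembly places at most one tile per unit square/facet with an orientation; two tiles on distinct squares sharing a side bind with strength $s$ if their glues on that side are equal of strength $s$ (bonds are flexible, so on a polycube tiles on orthogonal facets sharing an edge can bind). An assembly is $\tau$-stable if every cut of its binding graph breaks bonds of total strength at least $\tau$; producible assemblies are the seed and those obtained by adding one tile at a time keeping $\tau$-stability. The underlying rectangle of an assembly on $\mathbb{Z}^2$ is the smallest axis-parallel rectangle containing it. -}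

module Defs where

open import Data.Nat using (ℕ; zero; suc; _≤_) renaming (_+_ to _+ℕ_)
open import Data.Nat.DivMod using (_mod_)
open import Data.Integer using (ℤ; +_; -_) renaming (_+_ to _+ℤ_; _*_ to _*ℤ_; _-_ to _-ℤ_; _≤_ to _≤ℤ_)
import Data.Integer.Properties as ℤP
open import Data.Fin using (Fin; toℕ)
import Data.Fin.Properties as FinP
open import Data.Bool using (Bool; true; false; _∧_; not; if_then_else_) renaming (T to IsTrue)
open import Data.Unit using (tt)
open import Data.Maybe using (Maybe; just; nothing)
import Data.Maybe.Properties as MaybeP
open import Data.Vec using (Vec; lookup)
open import Data.List using (List; []; _∷_; map; allFin; _++_; [_]; length)
import Data.List
open import Data.Nat.ListAction using (sum)
import Data.List.Relation.Unary.Any as Any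
open import Data.List.Membership.Propositional using (_∈_; _∉_)
open import Data.Product using (Σ; _×_; _,_; proj₁; proj₂; ∃; ∃-syntax)
import Data.Product.Properties as ProdP
open import Relation.Binary.PropositionalEquality using (_≡_; refl; _≢_; cong)
open import Relation.Binary.Definitions using (DecidableEquality)
open import Relation.Nullary using (¬_; Dec; yes; no)
open import Relation.Nullary.Decidable using (⌊_⌋)
open import Function using (_⇔_)

-- Generic surfaces: a set of unit squares ("positions"), each with four
-- sides ("slots") numbered 0,1,2,3 in CLOCKWISE order (seen from the side
-- on which tiles lie).  `edge p k` identifies the geometric edge of side k
-- of square p; two distinct squares share a side iff their edges coincide.

record Surface : Set₁ where
  field
    Pos  : Set
    _≟P_ : DecidableEquality Pos
    EKey : Set
    _≟E_ : DecidableEquality EKey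
    edge : Pos → Fin 4 → EKey

  shared : Pos → Fin 4 → Pos → Fin 4 → Bool
  shared p k q k' = not ⌊ p ≟P q ⌋ ∧ ⌊ edge p k ≟E edge q k' ⌋

  Adj : Pos → Pos → Set
  Adj p q = ∃[ k ] ∃[ k' ] shared p k q k' ≡ true

-- Tile assembly systems (SFTAM).  Glues are `Maybe Glue`, `nothing` = ε.
-- A tile type is the 4-tuple (N , E , S , W) of its glues (clockwise).

record TAS : Set₁ where
  field
    Glue : Set
    _≟G_ : DecidableEquality Glue
    T    : List (Vec (Maybe Glue) 4)
    σ    : Vec (Maybe Glue) 4
    str  : Glue → ℕ
    τ    : ℕ

TileType : TAS → Set
TileType S = Vec (Maybe (TAS.Glue S)) 4

strε : (S : TAS) → Maybe (TAS.Glue S) → ℕ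
strε S nothing  = 0
strε S (just g) = TAS.str S g

eqGlue : (S : TAS) → Maybe (TAS.Glue S) → Maybe (TAS.Glue S) → Bool
eqGlue S a b = ⌊ MaybeP.≡-dec (TAS._≟G_ S) a b ⌋

-- a tile with rotation r has its side k on slot (k + r) mod 4
slot : Fin 4 → Fin 4 → Fin 4
slot k r = (toℕ k +ℕ toℕ r) mod 4

-- Assemblies on a surface: finite lists of placed tiles
-- (position, tile type, rotation).

Placement : TAS → Surface → Set
Placement S X = Surface.Pos X × TileType S × Fin 4

module _ (S : TAS) (X : Surface) where
  open TAS S
  open Surface X

  bond : Placement S X → Placement S X → ℕ
  bond (p , t , r) (q , u , r') =
    sum (map (λ k → sum (map (λ k' →
      if shared p (slot k r) q (slot k' r') ∧ eqGlue S (lookup t k) (lookup u k')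
      then strε S (lookup t k) else 0) (allFin 4))) (allFin 4))

  cutStrength : (α : List (Placement S X)) → (Fin (length α) → Bool) → ℕ
  cutStrength α A =
    sum (map (λ i → sum (map (λ j →
      if A i ∧ not (A j) then bond (Data.List.lookup α i) (Data.List.lookup α j) else 0)
      (allFin (length α)))) (allFin (length α)))

  Stable : List (Placement S X) → Set
  Stable α = (A : Fin (length α) → Bool) →
             (∃[ i ] A i ≡ true) → (∃[ j ] A j ≡ false) → τ ≤ cutStrength α A

  positions : List (Placement S X) → List Pos
  positions α = map proj₁ α

  data Producible : List (Placement S X) → Set where
    seed : ∀ p r → Producible [ (p , σ , r) ]
    grow : ∀ {α} p t r → Producible α → p ∉ positions α → t ∈ T →
           Stable (α ++ [ (p , t , r) ]) → Producible (α ++ [ (p , t , r) ])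

-- The plane ℤ²; slots 0,1,2,3 = N, E, S, W.

P2 : Set
P2 = ℤ × ℤ

dir2 : Fin 4 → P2
dir2 Fin.zero                       = (+ 0 , + 1)
dir2 (Fin.suc Fin.zero)             = (+ 1 , + 0)
dir2 (Fin.suc (Fin.suc Fin.zero))   = (+ 0 , - (+ 1))
dir2 (Fin.suc (Fin.suc (Fin.suc Fin.zero))) = (- (+ 1) , + 0)

_+2_ : P2 → P2 → P2
(a , b) +2 (c , d) = (a +ℤ c , b +ℤ d)

≟2 : DecidableEquality P2
≟2 = ProdP.≡-dec ℤP._≟_ ℤP._≟_

-- edges identified by their midpoints in doubled coordinates
Z2 : Surface
Z2 = record
  { Pos = P2 ; _≟P_ = ≟2 ; EKey = P2 ; _≟E_ = ≟2
  ; edge = λ { (x , y) k → ((+ 2) *ℤ x , (+ 2) *ℤ y) +2 dir2 k } }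

InRect : (S : TAS) → List (Placement S Z2) → P2 → Set
InRect S α (x , y) =
  (∃[ a ] (a ∈ positions S Z2 α × proj₁ a ≤ℤ x)) ×
  (∃[ b ] (b ∈ positions S Z2 α × x ≤ℤ proj₁ b)) ×
  (∃[ c ] (c ∈ positions S Z2 α × proj₂ c ≤ℤ y)) ×
  (∃[ d ] (d ∈ positions S Z2 α × y ≤ℤ proj₂ d))

-- Polycubes.  A unit cube is named by its minimal corner in ℤ³.

V3 : Set
V3 = ℤ × ℤ × ℤ

≟3 : DecidableEquality V3
≟3 = ProdP.≡-dec ℤP._≟_ (ProdP.≡-dec ℤP._≟_ ℤP._≟_)

_+3_ : V3 → V3 → V3
(a , b , c) +3 (d , e , f) = (a +ℤ d , b +ℤ e , c +ℤ f)

cross : V3 → V3 → V3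
cross (a1 , a2 , a3) (b1 , b2 , b3) =
  (a2 *ℤ b3 -ℤ a3 *ℤ b2 , a3 *ℤ b1 -ℤ a1 *ℤ b3 , a1 *ℤ b2 -ℤ a2 *ℤ b1)

dir6 : Fin 6 → V3
dir6 Fin.zero = (+ 1 , + 0 , + 0)
dir6 (Fin.suc Fin.zero) = (- (+ 1) , + 0 , + 0)
dir6 (Fin.suc (Fin.suc Fin.zero)) = (+ 0 , + 1 , + 0)
dir6 (Fin.suc (Fin.suc (Fin.suc Fin.zero))) = (+ 0 , - (+ 1) , + 0)
dir6 (Fin.suc (Fin.suc (Fin.suc (Fin.suc Fin.zero)))) = (+ 0 , + 0 , + 1)
dir6 (Fin.suc (Fin.suc (Fin.suc (Fin.suc (Fin.suc Fin.zero))))) = (+ 0 , + 0 , - (+ 1))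

perp0 : Fin 6 → V3
perp0 Fin.zero = (+ 0 , + 1 , + 0)
perp0 (Fin.suc Fin.zero) = (+ 0 , + 1 , + 0)
perp0 (Fin.suc (Fin.suc Fin.zero)) = (+ 0 , + 0 , + 1)
perp0 (Fin.suc (Fin.suc (Fin.suc Fin.zero))) = (+ 0 , + 0 , + 1)
perp0 (Fin.suc (Fin.suc (Fin.suc (Fin.suc Fin.zero)))) = (+ 0 , + 1 , + 0)
perp0 (Fin.suc (Fin.suc (Fin.suc (Fin.suc (Fin.suc Fin.zero))))) = (+ 0 , + 1 , + 0)

-- direction of slot k of a facet with outward normal d; successive slots
-- are obtained by e ↦ e × d, i.e. they go CLOCKWISE seen from outside
slotVec : Fin 6 → ℕ → V3
slotVec d zero    = perp0 d
slotVec d (suc k) = cross (slotVec d k) (dir6 d)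

_∈?C_ : V3 → List V3 → Bool
c ∈?C C = ⌊ Any.any? (≟3 c) C ⌋

-- (c , d) is a facet of the surface of C: c ∈ C and its neighbour c + d ∉ C
isFacet : List V3 → V3 × Fin 6 → Bool
isFacet C (c , d) = (c ∈?C C) ∧ not ((c +3 dir6 d) ∈?C C)

Facet : List V3 → Set
Facet C = Σ (V3 × Fin 6) (λ x → IsTrue (isFacet C x))

T-irr : ∀ b (u v : IsTrue b) → u ≡ v
T-irr true tt tt = refl

≟Facet : (C : List V3) → DecidableEquality (Facet C)
≟Facet C (x , u) (y , v) with ProdP.≡-dec ≟3 FinP._≟_ x y
... | yes refl = yes (cong (x ,_) (T-irr _ u v))
... | no ne = no (λ eq → ne (cong proj₁ eq))

-- the surface of C: edges identified by midpoints in doubled coordinates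
Surf : List V3 → Surface
Surf C = record
  { Pos = Facet C ; _≟P_ = ≟Facet C ; EKey = V3 ; _≟E_ = ≟3
  ; edge = λ { ((c , d) , _) k →
       (((+ 2) *ℤ proj₁ c , (+ 2) *ℤ proj₁ (proj₂ c) , (+ 2) *ℤ proj₂ (proj₂ c))
         +3 dir6 d) +3 slotVec d (toℕ k) } }

FaceAdj : V3 → V3 → Set
FaceAdj a b = ∃[ d ] b ≡ a +3 dir6 d

data Path (C : List V3) (a : V3) : V3 → Set where
  here : Path C a a
  step : ∀ {b c} → Path C a b → c ∈ C → FaceAdj b c → Path C a c

record Polycube : Set where
  field
    cubes     : List V3
    nonempty  : cubes ≢ []
    connected : ∀ a b → a ∈ cubes → b ∈ cubes → Path cubes a b

IsoOn : (R : P2 → Set) (C : List V3) → (P2 → Facet C) → Set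
IsoOn R C i =
  (∀ p q → R p → R q → i p ≡ i q → p ≡ q) ×
  (∀ p q → R p → R q → (Surface.Adj Z2 p q ⇔ Surface.Adj (Surf C) (i p) (i q)))

-- ρ p is the rotation by which orientations at p are transported to i p:
-- slot k of square p (towards p + dir2 k) becomes slot (k + ρ p) of i p,
-- which must be the edge shared with i (p + dir2 k) whenever both are in R
Corresponds : (R : P2 → Set) (C : List V3) → (P2 → Facet C) → (P2 → Fin 4) → Set
Corresponds R C i ρ = ∀ p k → R p → R (p +2 dir2 k) →
  ∃[ k' ] Surface.shared (Surf C) (i p) (slot k (ρ p)) (i (p +2 dir2 k)) k' ≡ true

image : (S : TAS) (C : List V3) → (P2 → Facet C) → (P2 → Fin 4) →
        List (Placement S Z2) → List (Placement S (Surf C))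
image S C i ρ α = map (λ { (p , t , r) → (i p , t , slot r (ρ p)) }) α

-- Every bond of α survives under i: two tiles bind across a side of the plane only if they
-- are neighbours, and Corresponds sends that side to an edge shared by their image facets.
-- Bonds may be gained but never lost, so every cut of the image is at least as strong as the
-- corresponding cut of α and τ-stability is preserved; the assembly sequence of α is then
-- transported tile by tile, injectivity of i on the rectangle keeping each new facet empty.
{-# OPTIONS --safe #-}
module Submission where

open import Defs
open import Data.Fin using (Fin)
open import Data.List using (List)

open import Data.Nat using (ℕ; z≤n) renaming (_≤_ to _≤ℕ_)
import Data.Nat.Properties as ℕ
open import Data.Nat.ListAction using (sum)
open import Data.Integer using (ℤ; +_) renaming (_+_ to _+ℤ_; _*_ to _*ℤ_; _-_ to _-ℤ_)
import Data.Integer.Properties as ℤ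
open import Data.Integer.Divisibility.Signed using (_∣_; divides; _∣?_)
open import Data.Integer.Tactic.RingSolver using (solve-∀)
open import Data.Fin using (toℕ; cast)
import Data.Fin.Properties as Fin
open import Data.Bool using (Bool; true; false; _∧_; not; if_then_else_; T)
open import Data.Bool.Properties using (T-≡; T-∧)
open import Data.Empty using (⊥; ⊥-elim)
open import Data.Sum using (_⊎_; inj₁; inj₂)
open import Data.Product using (Σ; _×_; _,_; proj₁; proj₂; ∃-syntax; map₂)
open import Data.List using ([]; _∷_; map; allFin; _++_; [_]; length; lookup)
import Data.List.Properties as List
import Data.Vec as Vec
open import Data.List.Membership.Propositional using (_∈_; _∉_)
open import Data.List.Membership.Propositional.Properties using (∈-map⁺; ∈-map⁻; ∈-++⁺ˡ; ∈-++⁺ʳ; ∈-lookup)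
open import Data.List.Relation.Unary.Any using (here)
open import Function using (_∘_; Equivalence; case_of_)
open import Relation.Binary.PropositionalEquality hiding ([_])
open import Relation.Nullary.Decidable
  using (⌊_⌋; toWitness; fromWitness; toWitnessFalse; fromWitnessFalse; _×-dec_; _⊎-dec_; _→-dec_)

infixl 6 _−2_ _−3_

sum-map-mono : ∀ {A : Set} (xs : List A) {f g : A → ℕ} →
               (∀ x → f x ≤ℕ g x) → sum (map f xs) ≤ℕ sum (map g xs)
sum-map-mono [] f≤g       = z≤n
sum-map-mono (x ∷ xs) f≤g = ℕ.+-mono-≤ (f≤g x) (sum-map-mono xs f≤g)

sum-allFin-cast : ∀ {m n} (m≡n : m ≡ n) (g : Fin n → ℕ) →
                  sum (map g (allFin n)) ≡ sum (map (g ∘ cast m≡n) (allFin m))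
sum-allFin-cast {m} refl g = cong sum (List.map-cong (cong g ∘ sym ∘ Fin.cast-is-id refl) (allFin m))

lookup-map-cast : ∀ {A B : Set} (f : A → B) (xs : List A) (k : Fin (length xs)) →
                  lookup (map f xs) (cast (sym (List.length-map f xs)) k) ≡ f (lookup xs k)
lookup-map-cast f (x ∷ xs) Fin.zero    = refl
lookup-map-cast f (x ∷ xs) (Fin.suc k) = lookup-map-cast f xs k

if-mono : ∀ b {x y} → x ≤ℕ y → (if b then x else 0) ≤ℕ (if b then y else 0)
if-mono true  x≤y = x≤y
if-mono false x≤y = z≤n

if-∧-mono : ∀ {b b'} c x → (b ≡ true → b' ≡ true) →
            (if b ∧ c then x else 0) ≤ℕ (if b' ∧ c then x else 0)
if-∧-mono {false} c x b⇒b' = z≤n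
if-∧-mono {true}  c x b⇒b' rewrite b⇒b' refl = ℕ.≤-refl

slot-assoc : ∀ k r s → slot k (slot r s) ≡ slot (slot k r) s
slot-assoc = toWitness {a? = Fin.all? λ k → Fin.all? λ r → Fin.all? λ s →
  slot k (slot r s) Fin.≟ slot (slot k r) s} _

module _ (X : Surface) where
  open Surface X

  record Shares (p : Pos) (k : Fin 4) (q : Pos) (k' : Fin 4) : Set where
    constructor shares
    field
      distinct  : p ≢ q
      same-edge : edge p k ≡ edge q k'

module _ {X : Surface} {p q : Surface.Pos X} {k k' : Fin 4} where
  open Surface X

  shared⇒Shares : shared p k q k' ≡ true → Shares X p k q k'
  shared⇒Shares h with Equivalence.to (T-∧ {not ⌊ p ≟P q ⌋}) (Equivalence.from T-≡ h)
  ... | p≢q , e =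
    shares (toWitnessFalse {a? = p ≟P q} p≢q) (toWitness {a? = edge p k ≟E edge q k'} e)

  Shares⇒shared : Shares X p k q k' → shared p k q k' ≡ true
  Shares⇒shared (shares p≢q e) =
    Equivalence.to T-≡ (Equivalence.from (T-∧ {not ⌊ p ≟P q ⌋}) (fromWitnessFalse p≢q , fromWitness e))

  Shares-sym : Shares X p k q k' → Shares X q k' p k
  Shares-sym (shares p≢q e) = shares (p≢q ∘ sym) (sym e)

module _ (S : TAS) {X Y : Surface} where

  bond-mono : ∀ {p t r q u r' p' s q' s'} →
    (∀ k k' → Shares X p (slot k r) q (slot k' r') → Shares Y p' (slot k s) q' (slot k' s')) →
    bond S X (p , t , r) (q , u , r') ≤ℕ bond S Y (p' , t , s) (q' , u , s')
  bond-mono {t = t} {u = u} shares⇒ =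
    sum-map-mono (allFin 4) λ k → sum-map-mono (allFin 4) λ k' →
      if-∧-mono (eqGlue S (Vec.lookup t k) (Vec.lookup u k')) (strε S (Vec.lookup t k))
        (Shares⇒shared ∘ shares⇒ k k' ∘ shared⇒Shares)

  module _ (f : Placement S X → Placement S Y) (β : List (Placement S X))
           (bond-≤ : ∀ {e e'} → e ∈ β → e' ∈ β → bond S X e e' ≤ℕ bond S Y (f e) (f e')) where

    private
      n≡m : length β ≡ length (map f β)
      n≡m = sym (List.length-map f β)

    cutStrength-map-mono : (A : Fin (length (map f β)) → Bool) →
      cutStrength S X β (A ∘ cast n≡m) ≤ℕ cutStrength S Y (map f β) A
    cutStrength-map-mono A = ℕ.≤-trans
      (sum-map-mono (allFin _) λ k → sum-map-mono (allFin _) λ j →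
        if-mono (A (cast n≡m k) ∧ not (A (cast n≡m j))) (bond-≤-lookup k j))
      (ℕ.≤-reflexive (sym reindex))
      where
      cutTerm : Fin (length (map f β)) → Fin (length (map f β)) → ℕ
      cutTerm k j = if A k ∧ not (A j) then bond S Y (lookup (map f β) k) (lookup (map f β) j) else 0

      bond-≤-lookup : ∀ k j → bond S X (lookup β k) (lookup β j) ≤ℕ
                              bond S Y (lookup (map f β) (cast n≡m k)) (lookup (map f β) (cast n≡m j))
      bond-≤-lookup k j rewrite lookup-map-cast f β k | lookup-map-cast f β j =
        bond-≤ (∈-lookup k) (∈-lookup j)

      reindex : cutStrength S Y (map f β) A ≡
                sum (map (λ k → sum (map (cutTerm (cast n≡m k) ∘ cast n≡m) (allFin _))) (allFin _))
      reindex = trans (sum-allFin-cast n≡m _)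
        (cong sum (List.map-cong (λ k → sum-allFin-cast n≡m (cutTerm (cast n≡m k))) (allFin _)))

    Stable-map : Stable S X β → Stable S Y (map f β)
    Stable-map stable A (k , Ak) (j , ¬Aj) = ℕ.≤-trans
      (stable (A ∘ cast n≡m) (cast m≡n k , back Ak) (cast m≡n j , back ¬Aj))
      (cutStrength-map-mono A)
      where
      m≡n : length (map f β) ≡ length β
      m≡n = List.length-map f β
      back : ∀ {k b} → A k ≡ b → A (cast n≡m (cast m≡n k)) ≡ b
      back {k} = trans (cong A (Fin.cast-involutive n≡m m≡n k))

module _ (S : TAS) {X Y : Surface} (i : Surface.Pos X → Surface.Pos Y) (ρ : Surface.Pos X → Fin 4) where

  transport : Placement S X → Placement S Y
  transport (p , t , r) = (i p , t , slot r (ρ p))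

  module _ (R : Surface.Pos X → Set)
           (i-injective : ∀ {p q} → R p → R q → i p ≡ i q → p ≡ q)
           (Shares-preserved : ∀ {p q a b} → R p → R q → Shares X p a q b →
                               Shares Y (i p) (slot a (ρ p)) (i q) (slot b (ρ q))) where

    transport-bond-mono : ∀ {e e'} → R (proj₁ e) → R (proj₁ e') →
                          bond S X e e' ≤ℕ bond S Y (transport e) (transport e')
    transport-bond-mono {p , t , r} {q , u , r'} Rp Rq = bond-mono S {t = t} {u = u} λ k k' →
      subst₂ (λ a b → Shares Y (i p) a (i q) b) (sym (slot-assoc k r (ρ p))) (sym (slot-assoc k' r' (ρ q)))
      ∘ Shares-preserved Rp Rq

    transport-∉ : ∀ {β p} → (∀ {e} → e ∈ β → R (proj₁ e)) → R p →
                  p ∉ positions S X β → i p ∉ positions S Y (map transport β)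
    transport-∉ {β} {p} within Rp p∉ ip∈
      with ∈-map⁻ (i ∘ proj₁) (subst (i p ∈_) (sym (List.map-∘ β)) ip∈)
    ... | e , e∈ , ip≡ie =
      p∉ (subst (_∈ positions S X β) (sym (i-injective Rp (within e∈) ip≡ie)) (∈-map⁺ proj₁ e∈))

    Producible-transport : ∀ {β} → Producible S X β → (∀ {e} → e ∈ β → R (proj₁ e)) →
                           Producible S Y (map transport β)
    Producible-transport (Producible.seed p r) within = Producible.seed (i p) (slot r (ρ p))
    Producible-transport (Producible.grow {β} p t r producible p∉ t∈T stable) within =
      subst (Producible S Y) (sym map-++)
        (Producible.grow (i p) t (slot r (ρ p))
          (Producible-transport producible (within ∘ ∈-++⁺ˡ))
          (transport-∉ (within ∘ ∈-++⁺ˡ) (within (∈-++⁺ʳ β (here refl))) p∉)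
          t∈T
          (subst (Stable S Y) map-++
            (Stable-map S {X} {Y} transport (β ++ [ (p , t , r) ])
              (λ {e} {e'} e∈ e'∈ → transport-bond-mono {e} {e'} (within e∈) (within e'∈)) stable)))
      where
      map-++ : map transport (β ++ [ (p , t , r) ]) ≡ map transport β ++ [ transport (p , t , r) ]
      map-++ = List.map-++ transport β _

halve-edge : ∀ (u v s t : ℤ) → (+ 2) *ℤ u +ℤ s ≡ (+ 2) *ℤ v +ℤ t → s -ℤ t ≡ (+ 2) *ℤ (v -ℤ u)
halve-edge u v s t e = begin
  s -ℤ t                                 ≡⟨ shift u s t ⟩
  ((+ 2) *ℤ u +ℤ s) -ℤ t -ℤ (+ 2) *ℤ u   ≡⟨ cong (λ m → m -ℤ t -ℤ (+ 2) *ℤ u) e ⟩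
  ((+ 2) *ℤ v +ℤ t) -ℤ t -ℤ (+ 2) *ℤ u   ≡⟨ unshift u v t ⟩
  (+ 2) *ℤ (v -ℤ u)                      ∎
  where
  open ≡-Reasoning
  shift : ∀ u s t → s -ℤ t ≡ ((+ 2) *ℤ u +ℤ s) -ℤ t -ℤ (+ 2) *ℤ u
  shift = solve-∀
  unshift : ∀ u v t → ((+ 2) *ℤ v +ℤ t) -ℤ t -ℤ (+ 2) *ℤ u ≡ (+ 2) *ℤ (v -ℤ u)
  unshift = solve-∀

halve-offset : ∀ (u v Δ : ℤ) → (+ 2) *ℤ (v -ℤ u) ≡ (+ 2) *ℤ Δ → v ≡ u +ℤ Δ
halve-offset u v Δ e = trans (v≡u+[v-u] u v) (cong (u +ℤ_) (ℤ.*-cancelˡ-≡ (+ 2) (v -ℤ u) Δ e))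
  where
  v≡u+[v-u] : ∀ u v → v ≡ u +ℤ (v -ℤ u)
  v≡u+[v-u] = solve-∀

2∣double : ∀ u → + 2 ∣ (+ 2) *ℤ u
2∣double u = divides u (ℤ.*-comm (+ 2) u)

double2 : P2 → P2
double2 (x , y) = ((+ 2) *ℤ x , (+ 2) *ℤ y)

_−2_ : P2 → P2 → P2
(x , y) −2 (x' , y') = (x -ℤ x' , y -ℤ y')

Even2 : P2 → Set
Even2 (x , y) = + 2 ∣ x × + 2 ∣ y

Even2-double : ∀ p → Even2 (double2 p)
Even2-double (x , y) = 2∣double x , 2∣double y

halve-edge2 : ∀ p q s t → double2 p +2 s ≡ double2 q +2 t → s −2 t ≡ double2 (q −2 p)
halve-edge2 (x , y) (x' , y') (s , s') (t , t') e =
  cong₂ _,_ (halve-edge x x' s t (cong proj₁ e)) (halve-edge y y' s' t' (cong proj₂ e))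

halve-offset2 : ∀ p q Δ → double2 (q −2 p) ≡ double2 Δ → q ≡ p +2 Δ
halve-offset2 (x , y) (x' , y') (δ , δ') e =
  cong₂ _,_ (halve-offset x x' δ (cong proj₁ e)) (halve-offset y y' δ' (cong proj₂ e))

+2-identityʳ : ∀ p → p +2 (+ 0 , + 0) ≡ p
+2-identityʳ (x , y) = cong₂ _,_ (ℤ.+-identityʳ x) (ℤ.+-identityʳ y)

dir2-differences : ∀ a b → Even2 (dir2 a −2 dir2 b) →
  dir2 a −2 dir2 b ≡ double2 (+ 0 , + 0) ⊎ dir2 a −2 dir2 b ≡ double2 (dir2 a)
dir2-differences = toWitness {a? = Fin.all? λ a → Fin.all? λ b →
  (_ ∣? _ ×-dec _ ∣? _) →-dec (≟2 _ _ ⊎-dec ≟2 _ _)} _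

Z2-Shares⇒neighbour : ∀ {p q a b} → Shares Z2 p a q b → q ≡ p +2 dir2 a
Z2-Shares⇒neighbour {p} {q} {a} {b} (shares p≢q e) =
  case dir2-differences a b (subst Even2 (sym difference) (Even2-double (q −2 p))) of λ where
    (inj₁ same)     →
      ⊥-elim (p≢q (sym (trans (halve-offset2 p q _ (trans (sym difference) same)) (+2-identityʳ p))))
    (inj₂ opposite) → halve-offset2 p q _ (trans (sym difference) opposite)
  where
  difference : dir2 a −2 dir2 b ≡ double2 (q −2 p)
  difference = halve-edge2 p q (dir2 a) (dir2 b) e

double3 : V3 → V3
double3 (x , y , z) = ((+ 2) *ℤ x , (+ 2) *ℤ y , (+ 2) *ℤ z)

_−3_ : V3 → V3 → V3
(x , y , z) −3 (x' , y' , z') = (x -ℤ x' , y -ℤ y' , z -ℤ z')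

Even3 : V3 → Set
Even3 (x , y , z) = + 2 ∣ x × + 2 ∣ y × + 2 ∣ z

origin3 : V3
origin3 = (+ 0 , + 0 , + 0)

Even3-double : ∀ c → Even3 (double3 c)
Even3-double (x , y , z) = 2∣double x , 2∣double y , 2∣double z

halve-edge3 : ∀ c k s t → double3 c +3 s ≡ double3 k +3 t → s −3 t ≡ double3 (k −3 c)
halve-edge3 (x , y , z) (x' , y' , z') (s , s' , s'') (t , t' , t'') e =
  cong₂ _,_ (halve-edge x x' s t (cong proj₁ e))
    (cong₂ _,_ (halve-edge y y' s' t' (cong (proj₁ ∘ proj₂) e)) (halve-edge z z' s'' t'' (cong (proj₂ ∘ proj₂) e)))

halve-offset3 : ∀ c k Δ → double3 (k −3 c) ≡ double3 Δ → k ≡ c +3 Δ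
halve-offset3 (x , y , z) (x' , y' , z') (δ , δ' , δ'') e =
  cong₂ _,_ (halve-offset x x' δ (cong proj₁ e))
    (cong₂ _,_ (halve-offset y y' δ' (cong (proj₁ ∘ proj₂) e)) (halve-offset z z' δ'' (cong (proj₂ ∘ proj₂) e)))

+3-identityʳ : ∀ c → c +3 origin3 ≡ c
+3-identityʳ (x , y , z) = cong₂ _,_ (ℤ.+-identityʳ x) (cong₂ _,_ (ℤ.+-identityʳ y) (ℤ.+-identityʳ z))

+3-assoc : ∀ u v w → (u +3 v) +3 w ≡ u +3 (v +3 w)
+3-assoc (x , y , z) (x' , y' , z') (x'' , y'' , z'') =
  cong₂ _,_ (ℤ.+-assoc x x' x'') (cong₂ _,_ (ℤ.+-assoc y y' y'') (ℤ.+-assoc z z' z''))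

offset : Fin 6 → Fin 4 → V3
offset d k = dir6 d +3 slotVec d (toℕ k)

cube : ∀ {P : V3 × Fin 6 → Set} → Σ (V3 × Fin 6) P → V3
cube ((c , _) , _) = c

normal : ∀ {P : V3 × Fin 6 → Set} → Σ (V3 × Fin 6) P → Fin 6
normal ((_ , d) , _) = d

module _ {C : List V3} where

  Facet-≡ : {F G : Facet C} → proj₁ F ≡ proj₁ G → F ≡ G
  Facet-≡ {_ , pF} {_ , pG} refl = cong (_ ,_) (T-irr _ pF pG)

  cube-not-outward-neighbour : (F G : Facet C) → cube G ≢ cube F +3 dir6 (normal F)
  cube-not-outward-neighbour ((c , d) , pF) ((k , _) , pG) refl =
    not-both (proj₁ (Equivalence.to (T-∧ {k ∈?C C}) pG)) (proj₂ (Equivalence.to (T-∧ {c ∈?C C}) pF))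
    where
    not-both : ∀ {b} → T b → T (not b) → ⊥
    not-both {true} _ ()

  Surf-edge : (F : Facet C) (k : Fin 4) → Surface.edge (Surf C) F k ≡ double3 (cube F) +3 offset (normal F) k
  Surf-edge F k = +3-assoc (double3 (cube F)) (dir6 (normal F)) (slotVec (normal F) (toℕ k))

  Surf-Shares⇒offset : ∀ F G x y → Shares (Surf C) F x G y →
                       offset (normal F) x −3 offset (normal G) y ≡ double3 (cube G −3 cube F)
  Surf-Shares⇒offset F G x y (shares _ e) =
    halve-edge3 (cube F) (cube G) _ _ (trans (sym (Surf-edge F x)) (trans e (Surf-edge G y)))

-- v is twice the difference of the cubes of two facets sharing edges, so the last two cases put
-- the second facet on the cube of the first one or on its outward neighbour.
offset-differences : ∀ d d' x y w z → let v = offset d x −3 offset d' y in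
  v ≡ offset d w −3 offset d' z → Even3 v →
  y ≡ z ⊎ (v ≡ double3 origin3 × d ≡ d') ⊎ v ≡ double3 (dir6 d)
offset-differences = toWitness {a? = Fin.all? λ d → Fin.all? λ d' → Fin.all? λ x → Fin.all? λ y →
  Fin.all? λ w → Fin.all? λ z →
  ≟3 _ _ →-dec (_ ∣? _ ×-dec _ ∣? _ ×-dec _ ∣? _) →-dec
  (y Fin.≟ z ⊎-dec (≟3 _ _ ×-dec d Fin.≟ d') ⊎-dec ≟3 _ _)} _

Surf-Shares-unique : ∀ {C} {F G : Facet C} {x y w z} →
  Shares (Surf C) F x G y → Shares (Surf C) F w G z → y ≡ z
Surf-Shares-unique {C} {F} {G} {x} {y} {w} {z} sh@(shares F≢G _) sh' =
  case offset-differences (normal F) (normal G) x y w z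
         (trans v≡ (sym (Surf-Shares⇒offset F G w z sh')))
         (subst Even3 (sym v≡) (Even3-double (cube G −3 cube F))) of λ where
    (inj₁ y≡z)                 → y≡z
    (inj₂ (inj₁ (v≡0 , d≡d'))) → ⊥-elim (F≢G (Facet-≡ {C} {F} {G} (cong₂ _,_ (same-cube v≡0) d≡d')))
    (inj₂ (inj₂ v≡2d))         → ⊥-elim (cube-not-outward-neighbour {C} F G (outward-cube v≡2d))
  where
  v : V3
  v = offset (normal F) x −3 offset (normal G) y

  v≡ : v ≡ double3 (cube G −3 cube F)
  v≡ = Surf-Shares⇒offset F G x y sh

  same-cube : v ≡ double3 origin3 → cube F ≡ cube G
  same-cube v≡0 =
    sym (trans (halve-offset3 (cube F) (cube G) origin3 (trans (sym v≡) v≡0)) (+3-identityʳ (cube F)))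

  outward-cube : v ≡ double3 (dir6 (normal F)) → cube G ≡ cube F +3 dir6 (normal F)
  outward-cube v≡2d = halve-offset3 (cube F) (cube G) (dir6 (normal F)) (trans (sym v≡) v≡2d)

module _ {R : P2 → Set} {C : List V3} {i : P2 → Facet C} {ρ : P2 → Fin 4}
         (corresponds : Corresponds R C i ρ) where

  Corresponds⇒some-Shares : ∀ {p q a b} → R p → R q → Shares Z2 p a q b →
                            ∃[ k ] Shares (Surf C) (i p) (slot a (ρ p)) (i q) k
  Corresponds⇒some-Shares {p} {a = a} Rp Rq sh with Z2-Shares⇒neighbour sh
  ... | refl = map₂ shared⇒Shares (corresponds p a Rp Rq)

  -- Corresponds only fixes the slot on the side of i p; applying it from q as well and using
  -- uniqueness of shared edges pins the slot on the side of i q down to slot b (ρ q).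
  Corresponds⇒Shares-preserved : ∀ {p q a b} → R p → R q → Shares Z2 p a q b →
                                 Shares (Surf C) (i p) (slot a (ρ p)) (i q) (slot b (ρ q))
  Corresponds⇒Shares-preserved {p} {q} {a} Rp Rq sh
    with Corresponds⇒some-Shares Rp Rq sh | Corresponds⇒some-Shares Rq Rp (Shares-sym sh)
  ... | _ , sh₁ | _ , sh₂ =
    subst (Shares (Surf C) (i p) (slot a (ρ p)) (i q)) (Surf-Shares-unique sh₁ (Shares-sym sh₂)) sh₁

positions⊆InRect : ∀ {S α e} → e ∈ α → InRect S α (proj₁ e)
positions⊆InRect e∈ = let p∈ = ∈-map⁺ proj₁ e∈ in
  (_ , p∈ , ℤ.≤-refl) , (_ , p∈ , ℤ.≤-refl) , (_ , p∈ , ℤ.≤-refl) , (_ , p∈ , ℤ.≤-refl)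

mainTheorem2 : (S : TAS) (α : List (Placement S Z2)) → Producible S Z2 α →
    (C : Polycube) (i : P2 → Facet (Polycube.cubes C)) →
    IsoOn (InRect S α) (Polycube.cubes C) i →
    (ρ : P2 → Fin 4) → Corresponds (InRect S α) (Polycube.cubes C) i ρ →
    Producible S (Surf (Polycube.cubes C)) (image S (Polycube.cubes C) i ρ α)
mainTheorem2 S α producible C i (i-injective , _) ρ corresponds =
  Producible-transport S {Z2} {Surf (Polycube.cubes C)} i ρ (InRect S α)
    (i-injective _ _) (Corresponds⇒Shares-preserved corresponds) producible (positions⊆InRect {S})
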